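{- In $\mathsf{PG}(2,8)$ let $\mathcal{K}:X^2+YZ=0$, and let $A=(1,1,0)$, $C_1=(0,1,1)$, $C_2=(\gamma,\gamma^6,1)$, $C_3=(\gamma^2,\gamma^5,1)$, $C_4=(\gamma^4,\gamma^3,1)$. For every even permutation $\pi$ of $\{1,2,3,4\}$, written in one-line notation as $ijk\ell$ (i.e. $\pi(1)=i,\pi(2)=j,\pi(3)=k,\pi(4)=\ell$), let $d_{ijk\ell}$ be the line joining the points $AC_i\cap C_jC_\ell$ and $AC_j\cap C_kC_\ell$. Then: (i) the group $G_0=\langle\Gamma,\Phi\rangle$ acts regularly on the set of the lines $d_{ijk\ell}$; in particular these twelve lines are pairwise distinct; (ii) every line $d_{ijk\ell}$ is external to $\mathcal{K}$; (iii) for each coset $\sigma V_4$ of the Klein four-group $V_4=\{\mathrm{id},(12)(34),(13)(24),(14)(23)\}$ in $A_4$, the four lines $d_{\pi(1)\pi(2)\pi(3)\pi(4)}$, $\pi\in\sigma V_4$, pass through a common point of the line $Z=0$; (iv) the lines $AC_4$, $d_{1234}$ and $d_{3241}$ are concurrent.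
   Context: $\gamma\in\mathbb{F}_8$ is a fixed root of $X^3+X+1$; $\operatorname{tr}(x)=x+x^2+x^4$. $\Phi$ is the collineation $(x,y,z)\mapsto(x^2,y^2,z^2)$; for $c\in\mathbb{F}_8$, $\tau_c:(x,y,z)\mapsto(x+cz,y+c^2z,z)$; $\Gamma=\{\tau_c\mid\operatorname{tr}(c)=0\}$. A line is external to $\mathcal{K}$ if it misses $\mathcal{K}$. -}

module Defs where

open import Data.Bool using (Bool; true; false; _xor_; _∧_)
open import Data.Nat using (ℕ; zero; suc; _%_)
open import Data.Fin using (Fin; _<?_)
open import Data.List using (List; []; _∷_; length; filter; concatMap; map)
open import Data.List using () renaming (allFin to allFinL)
open import Data.Product using (_×_; _,_; Σ; ∃; proj₁)
open import Relation.Binary.PropositionalEquality using (_≡_; _≢_)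
open import Relation.Nullary using (¬_)
open import Function.Definitions using (Injective)

-- The field F_8 = F_2[γ]/(γ^3+γ+1), elements b0 + b1 γ + b2 γ^2

record F8 : Set where
  constructor mk
  field
    b0 b1 b2 : Bool

0F 1F γ : F8
0F = mk false false false
1F = mk true false false
γ  = mk false true false

infixl 6 _+F_
infixl 7 _*F_

_+F_ : F8 → F8 → F8
mk a0 a1 a2 +F mk b0 b1 b2 = mk (a0 xor b0) (a1 xor b1) (a2 xor b2)

-- multiplication using γ^3 = γ + 1, γ^4 = γ^2 + γ
_*F_ : F8 → F8 → F8
mk a0 a1 a2 *F mk b0 b1 b2 =
  mk ((a0 ∧ b0) xor (a1 ∧ b2) xor (a2 ∧ b1))
     ((a0 ∧ b1) xor (a1 ∧ b0) xor (a1 ∧ b2) xor (a2 ∧ b1) xor (a2 ∧ b2))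
     ((a0 ∧ b2) xor (a1 ∧ b1) xor (a2 ∧ b0) xor (a2 ∧ b2))

_^F_ : F8 → ℕ → F8
x ^F zero  = 1F
x ^F suc n = x *F (x ^F n)

tr : F8 → F8
tr x = x +F x ^F 2 +F x ^F 4

V3 : Set
V3 = F8 × F8 × F8

zeroV : V3
zeroV = 0F , 0F , 0F

NonZero3 : V3 → Set
NonZero3 v = v ≢ zeroV

scale : F8 → V3 → V3
scale l (x , y , z) = l *F x , l *F y , l *F z

_∼_ : V3 → V3 → Set
u ∼ v = Σ F8 λ l → l ≢ 0F × u ≡ scale l v

-- cross product: for points P ≠ Q it gives the coordinates of the line PQ,
-- for lines ℓ ≠ m it gives the coordinates of the point ℓ ∩ m
cross : V3 → V3 → V3
cross (a , b , c) (d , e , f) = (b *F f +F c *F e) , (c *F d +F a *F f) , (a *F e +F b *F d)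

join : V3 → V3 → V3
join = cross

meet : V3 → V3 → V3
meet = cross

On : V3 → V3 → Set
On (x , y , z) (a , b , c) = a *F x +F b *F y +F c *F z ≡ 0F

OnK : V3 → Set
OnK (x , y , z) = x *F x +F y *F z ≡ 0F

External : V3 → Set
External l = ∀ (P : V3) → NonZero3 P → On P l → ¬ OnK P

lineZ : V3
lineZ = 0F , 0F , 1F

Φ : V3 → V3
Φ (x , y , z) = x *F x , y *F y , z *F z

τ : F8 → V3 → V3
τ c (x , y , z) = x +F c *F z , y +F c *F c *F z , z

data Gen : Set where
  gτ : (c : F8) → tr c ≡ 0F → Gen
  gΦ : Gen

actGen : Gen → V3 → V3
actGen (gτ c _) = τ c
actGen gΦ       = Φ

-- elements of G0 = ⟨Γ, Φ⟩ as words in the generators (G0 is finite,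
-- so the generated subgroup equals the generated monoid)
G0 : Set
G0 = List Gen

act : G0 → V3 → V3
act []      P = P
act (g ∷ w) P = actGen g (act w P)

MapsLine : G0 → V3 → V3 → Set
MapsLine g l l' = ∀ (P : V3) → NonZero3 P → On P l → On (act g P) l'

IsId : G0 → Set
IsId g = ∀ (P : V3) → NonZero3 P → act g P ∼ P

-- Permutations of {1,2,3,4} (as Fin 4, so 1 ↦ 0, …, 4 ↦ 3)

Perm4 : Set
Perm4 = Fin 4 → Fin 4

inversions : Perm4 → ℕ
inversions π =
  length (concatMap (λ i → filter (λ j → π j <? π i)
                              (filter (λ j → i <? j) (allFinL 4)))
                    (allFinL 4))

IsEvenPerm : Perm4 → Set
IsEvenPerm π = Injective _≡_ _≡_ π × inversions π % 2 ≡ 0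

ptA : V3
ptA = 1F , 1F , 0F

ptC : Fin 4 → V3
ptC Fin.zero                      = 0F , 1F , 1F
ptC (Fin.suc Fin.zero)            = γ , γ ^F 6 , 1F
ptC (Fin.suc (Fin.suc Fin.zero))  = γ ^F 2 , γ ^F 5 , 1F
ptC (Fin.suc (Fin.suc (Fin.suc Fin.zero))) = γ ^F 4 , γ ^F 3 , 1F

d : Perm4 → V3
d π = join (meet (join ptA (ptC (π 0F4))) (join (ptC (π 1F4)) (ptC (π 3F4))))
           (meet (join ptA (ptC (π 1F4))) (join (ptC (π 2F4)) (ptC (π 3F4))))
  where
    0F4 1F4 2F4 3F4 : Fin 4
    0F4 = Fin.zero
    1F4 = Fin.suc Fin.zero
    2F4 = Fin.suc (Fin.suc Fin.zero)
    3F4 = Fin.suc (Fin.suc (Fin.suc Fin.zero))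

pattern f0 = Fin.zero
pattern f1 = Fin.suc Fin.zero
pattern f2 = Fin.suc (Fin.suc Fin.zero)
pattern f3 = Fin.suc (Fin.suc (Fin.suc Fin.zero))

perm : Fin 4 → Fin 4 → Fin 4 → Fin 4 → Perm4
perm a b c e f0 = a
perm a b c e f1 = b
perm a b c e f2 = c
perm a b c e f3 = e

V4 : Fin 4 → Perm4
V4 f0 = perm f0 f1 f2 f3
V4 f1 = perm f1 f0 f3 f2
V4 f2 = perm f2 f3 f0 f1
V4 f3 = perm f3 f2 f1 f0

p1234 p3241 : Perm4
p1234 = perm f0 f1 f2 f3
p3241 = perm f2 f1 f3 f0

-- Every word in the generators of G0 acts as τ_c ∘ Φ^k with tr c = 0, because
-- τ_c τ_c′ = τ_(c+c′), Φ τ_c = τ_(c²) Φ, Φ³ = 1 and the trace is additive and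
-- Frobenius-invariant; so G0 has at most twelve elements. An even permutation of
-- {1,2,3,4} is one of twelve explicit one-line tables, so every claim becomes a finite
-- incidence computation in PG(2,8) over the 512 coordinate vectors, decided by
-- exhaustive search: closure of the twelve lines under G0 is checked on generators,
-- transitivity through the orbit of d_1234, and freeness on the twelve normal forms.
module Submission where

open import Defs
open import Data.Bool using (Bool; true; false)
import Data.Bool.Properties as Bool
open import Data.Fin using (Fin; _<?_)
import Data.Fin.Properties as Fin
open import Data.List using (List; []; _∷_; _++_; length; filter; concatMap) renaming (allFin to allFinL)
open import Data.List.Properties using (concatMap-cong)
open import Data.List.Membership.Propositional using (_∈_; find)
open import Data.List.Relation.Unary.All as All using (All)
open import Data.List.Relation.Unary.Any as Any using (Any)
open import Data.Nat using (_%_)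
import Data.Nat as ℕ
open import Data.Product using (_×_; Σ; ∃; _,_)
open import Data.Product.Properties using (≡-dec)
open import Data.Sum using (inj₁; inj₂; [_,_])
open import Function using (_∘_; id)
open import Relation.Binary.Definitions using (DecidableEquality)
open import Relation.Binary.PropositionalEquality
  using (_≡_; refl; sym; trans; cong; cong₂; subst; subst₂; _≗_; module ≡-Reasoning)
open import Relation.Nullary using (Dec; does; ¬?)
open import Relation.Nullary.Decidable using (map′; _×-dec_; _⊎-dec_; _→-dec_; from-yes)
open import Relation.Unary using (Decidable)

record Exhaustible (A : Set) : Set₁ where
  field
    all? : {P : A → Set} → Decidable P → Dec (∀ x → P x)
    any? : {P : A → Set} → Decidable P → Dec (∃ P)

open Exhaustible {{...}}

instance
  Bool-exhaustible : Exhaustible Bool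
  Bool-exhaustible = record
    { all? = λ P? → map′ (λ { (t , f) → λ { true → t ; false → f } }) (λ h → h true , h false)
                         (P? true ×-dec P? false)
    ; any? = λ P? → map′ [ (true ,_) , (false ,_) ] (λ { (true , p) → inj₁ p ; (false , p) → inj₂ p })
                         (P? true ⊎-dec P? false)
    }

  Fin-exhaustible : ∀ {n} → Exhaustible (Fin n)
  Fin-exhaustible = record { all? = Fin.all? ; any? = Fin.any? }

  ×-exhaustible : ∀ {A B} → {{Exhaustible A}} → {{Exhaustible B}} → Exhaustible (A × B)
  ×-exhaustible = record
    { all? = λ P? → map′ (λ h (a , b) → h a b) (λ h a b → h (a , b)) (all? λ a → all? λ b → P? (a , b))
    ; any? = λ P? → map′ (λ (a , b , p) → (a , b) , p) (λ ((a , b) , p) → a , b , p)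
                         (any? λ a → any? λ b → P? (a , b))
    }

surjection-exhaustible : ∀ {A B} (f : A → B) (g : B → A) → (∀ b → f (g b) ≡ b) →
                         {{Exhaustible A}} → Exhaustible B
surjection-exhaustible f g fg = record
  { all? = λ {P} P? → map′ (λ h b → subst P (fg b) (h (g b))) (λ h a → h (f a)) (all? (P? ∘ f))
  ; any? = λ {P} P? → map′ (λ (a , p) → f a , p) (λ (b , p) → g b , subst P (sym (fg b)) p)
                           (any? (P? ∘ f))
  }

instance
  F8-exhaustible : Exhaustible F8
  F8-exhaustible =
    surjection-exhaustible (λ (a , b , c) → mk a b c) (λ (mk a b c) → a , b , c) (λ _ → refl)

filter-cong : ∀ {A : Set} {P Q : A → Set} (P? : Decidable P) (Q? : Decidable Q) →
              (∀ x → does (P? x) ≡ does (Q? x)) → filter P? ≗ filter Q?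
filter-cong P? Q? eq [] = refl
filter-cong P? Q? eq (x ∷ xs) with does (P? x) | does (Q? x) | eq x
... | false | false | refl = filter-cong P? Q? eq xs
... | true  | true  | refl = cong (x ∷_) (filter-cong P? Q? eq xs)

infix 4 _≟F_ _≟V_ _∼?_

_≟F_ : DecidableEquality F8
mk a₀ a₁ a₂ ≟F mk b₀ b₁ b₂ = map′ (λ { (refl , refl , refl) → refl }) (λ { refl → refl , refl , refl })
                                   (a₀ Bool.≟ b₀ ×-dec a₁ Bool.≟ b₁ ×-dec a₂ Bool.≟ b₂)

_≟V_ : DecidableEquality V3
_≟V_ = ≡-dec _≟F_ (≡-dec _≟F_ _≟F_)

On? : ∀ P l → Dec (On P l)
On? (x , y , z) (a , b , c) = a *F x +F b *F y +F c *F z ≟F 0F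

OnK? : ∀ P → Dec (OnK P)
OnK? (x , y , z) = x *F x +F y *F z ≟F 0F

_∼?_ : ∀ u v → Dec (u ∼ v)
u ∼? v = any? λ l → ¬? (l ≟F 0F) ×-dec u ≟V scale l v

External? : ∀ l → Dec (External l)
External? l = all? λ P → ¬? (P ≟V zeroV) →-dec On? P l →-dec ¬? (OnK? P)

record Sends (f : V3 → V3) (l l′ : V3) : Set where
  constructor sends
  field apply : ∀ P → NonZero3 P → On P l → On (f P) l′

Sends? : ∀ f l l′ → Dec (Sends f l l′)
Sends? f l l′ =
  map′ sends Sends.apply (all? λ P → ¬? (P ≟V zeroV) →-dec On? P l →-dec On? (f P) l′)

Sends-≗ : ∀ {f g l l′} → f ≗ g → Sends f l l′ → Sends g l l′
Sends-≗ {l′ = l′} f≗g (sends s) =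
  sends λ P P≢0 P∈l → subst (λ Q → On Q l′) (f≗g P) (s P P≢0 P∈l)

Sends-∘ : ∀ {f g l l′ l″} → (∀ P → NonZero3 P → NonZero3 (f P)) →
          Sends g l′ l″ → Sends f l l′ → Sends (g ∘ f) l l″
Sends-∘ {f} f-nonzero (sends sg) (sends sf) =
  sends λ P P≢0 P∈l → sg (f P) (f-nonzero P P≢0) (sf P P≢0 P∈l)

scale-one : ∀ P → scale 1F P ≡ P
scale-one = from-yes (all? λ P → scale 1F P ≟V P)

∼-refl : ∀ P → P ∼ P
∼-refl P = 1F , (λ ()) , sym (scale-one P)

tr-+ : ∀ a b → tr (a +F b) ≡ tr a +F tr b
tr-+ = from-yes (all? λ a → all? λ b → tr (a +F b) ≟F tr a +F tr b)

tr-square : ∀ a → tr (a *F a) ≡ tr a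
tr-square = from-yes (all? λ a → tr (a *F a) ≟F tr a)

τ-zero : ∀ P → τ 0F P ≡ P
τ-zero = from-yes (all? λ P → τ 0F P ≟V P)

τ-τ : ∀ c c′ P → τ c (τ c′ P) ≡ τ (c +F c′) P
τ-τ = from-yes (all? λ c → all? λ c′ → all? λ P → τ c (τ c′ P) ≟V τ (c +F c′) P)

Φ-τ : ∀ c P → Φ (τ c P) ≡ τ (c *F c) (Φ P)
Φ-τ = from-yes (all? λ c → all? λ P → Φ (τ c P) ≟V τ (c *F c) (Φ P))

Φ-Φ-Φ : ∀ P → Φ (Φ (Φ P)) ≡ P
Φ-Φ-Φ = from-yes (all? λ P → Φ (Φ (Φ P)) ≟V P)

τ-nonzero : ∀ c P → NonZero3 P → NonZero3 (τ c P)
τ-nonzero = from-yes (all? λ c → all? λ P → ¬? (P ≟V zeroV) →-dec ¬? (τ c P ≟V zeroV))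

Φ-nonzero : ∀ P → NonZero3 P → NonZero3 (Φ P)
Φ-nonzero = from-yes (all? λ P → ¬? (P ≟V zeroV) →-dec ¬? (Φ P ≟V zeroV))

Φ^ : Fin 3 → V3 → V3
Φ^ f0 = id
Φ^ f1 = Φ
Φ^ f2 = Φ ∘ Φ

next : Fin 3 → Fin 3
next f0 = f1
next f1 = f2
next f2 = f0

Φ-Φ^ : ∀ k P → Φ (Φ^ k P) ≡ Φ^ (next k) P
Φ-Φ^ f0 P = refl
Φ-Φ^ f1 P = refl
Φ-Φ^ f2 P = Φ-Φ-Φ P

record NormalForm (w : G0) : Set where
  field
    shift       : F8
    shift-trace : tr shift ≡ 0F
    power       : Fin 3
    act-≗       : act w ≗ τ shift ∘ Φ^ power

normalForm : ∀ w → NormalForm w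
normalForm [] = record { shift = 0F ; shift-trace = refl ; power = f0 ; act-≗ = sym ∘ τ-zero }
normalForm (gτ c trc ∷ w) = record
  { shift       = c +F shift
  ; shift-trace = trans (tr-+ c shift) (cong₂ _+F_ trc shift-trace)
  ; power       = power
  ; act-≗       = λ P → trans (cong (τ c) (act-≗ P)) (τ-τ c shift (Φ^ power P))
  }
  where open NormalForm (normalForm w)
normalForm (gΦ ∷ w) = record
  { shift       = shift *F shift
  ; shift-trace = trans (tr-square shift) shift-trace
  ; power       = next power
  ; act-≗       = λ P → begin
      Φ (act w P)                             ≡⟨ cong Φ (act-≗ P) ⟩
      Φ (τ shift (Φ^ power P))                ≡⟨ Φ-τ shift (Φ^ power P) ⟩
      τ (shift *F shift) (Φ (Φ^ power P))     ≡⟨ cong (τ (shift *F shift)) (Φ-Φ^ power P) ⟩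
      τ (shift *F shift) (Φ^ (next power) P)  ∎
  }
  where open NormalForm (normalForm w)
        open ≡-Reasoning

normalWord : (c : F8) → tr c ≡ 0F → Fin 3 → G0
normalWord c trc f0 = gτ c trc ∷ []
normalWord c trc f1 = gτ c trc ∷ gΦ ∷ []
normalWord c trc f2 = gτ c trc ∷ gΦ ∷ gΦ ∷ []

act-normalWord : ∀ c trc k → act (normalWord c trc k) ≗ τ c ∘ Φ^ k
act-normalWord c trc f0 P = refl
act-normalWord c trc f1 P = refl
act-normalWord c trc f2 P = refl

act-nonzero : ∀ w P → NonZero3 P → NonZero3 (act w P)
act-nonzero []           P = id
act-nonzero (gτ c _ ∷ w) P = τ-nonzero c (act w P) ∘ act-nonzero w P
act-nonzero (gΦ ∷ w)     P = Φ-nonzero (act w P) ∘ act-nonzero w P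

act-++ : ∀ u w → act (u ++ w) ≗ act u ∘ act w
act-++ []      w P = refl
act-++ (g ∷ u) w P = cong (actGen g) (act-++ u w P)

Reachable : V3 → V3 → Set
Reachable l l′ = Σ G0 λ g → Sends (act g) l l′

Reachable-trans : ∀ {l l′ l″} → Reachable l l′ → Reachable l′ l″ → Reachable l l″
Reachable-trans (u , su) (w , sw) =
  w ++ u , Sends-≗ (sym ∘ act-++ w u) (Sends-∘ (act-nonzero u) sw su)

NormalSends : V3 → V3 → Set
NormalSends l l′ = Σ F8 λ c → tr c ≡ 0F × Σ (Fin 3) λ k → Sends (τ c ∘ Φ^ k) l l′

NormalSends? : ∀ l l′ → Dec (NormalSends l l′)
NormalSends? l l′ = any? λ c → tr c ≟F 0F ×-dec any? λ k → Sends? (τ c ∘ Φ^ k) l l′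

NormalSends⇒Reachable : ∀ {l l′} → NormalSends l l′ → Reachable l l′
NormalSends⇒Reachable (c , trc , k , s) =
  normalWord c trc k , Sends-≗ (sym ∘ act-normalWord c trc k) s

Table : Set
Table = Fin 4 × Fin 4 × Fin 4 × Fin 4

_≟T_ : DecidableEquality Table
_≟T_ = ≡-dec Fin._≟_ (≡-dec Fin._≟_ (≡-dec Fin._≟_ Fin._≟_))

table : Perm4 → Table
table π = π f0 , π f1 , π f2 , π f3

fromTable : Table → Perm4
fromTable (a , b , c , e) = perm a b c e

fromTable-table : ∀ π → fromTable (table π) ≗ π
fromTable-table π f0 = refl
fromTable-table π f1 = refl
fromTable-table π f2 = refl
fromTable-table π f3 = refl

table-cong : ∀ {π π′} → π ≗ π′ → table π ≡ table π′
table-cong eq = cong₂ _,_ (eq f0) (cong₂ _,_ (eq f1) (cong₂ _,_ (eq f2) (eq f3)))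

line : Table → V3
line t = d (fromTable t)

-- Proved once by conversion and transported along everywhere else: leaving this
-- conversion to the type checker inside larger types makes it normalise the
-- symbolic coordinates of d π.
line-table : ∀ π → line (table π) ≡ d π
line-table π = refl

d-cong : ∀ π π′ → π ≗ π′ → d π ≡ d π′
d-cong π π′ eq = trans (sym (line-table π)) (trans (cong line (table-cong eq)) (line-table π′))

inversions-cong : ∀ {π π′} → π ≗ π′ → inversions π ≡ inversions π′
inversions-cong {π} {π′} eq = cong length (concatMap-cong inversionsAt-cong (allFinL 4))
  where
    inversionsAt-cong : ∀ i → filter (λ j → π j <? π i) (filter (i <?_) (allFinL 4))
                            ≡ filter (λ j → π′ j <? π′ i) (filter (i <?_) (allFinL 4))
    inversionsAt-cong i = filter-cong (λ j → π j <? π i) (λ j → π′ j <? π′ i)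
      (λ j → cong₂ (λ a b → does (a <? b)) (eq j) (eq i)) (filter (i <?_) (allFinL 4))

IsEvenPerm-resp : ∀ {π π′} → π ≗ π′ → IsEvenPerm π → IsEvenPerm π′
IsEvenPerm-resp {π} {π′} eq (inj , even) =
  (λ {x} {y} p → inj (trans (eq x) (trans p (sym (eq y))))) ,
  trans (cong (_% 2) (sym (inversions-cong eq))) even

IsEvenPerm? : ∀ t → Dec (IsEvenPerm (fromTable t))
IsEvenPerm? t = map′ (λ inj {x} {y} → inj x y) (λ inj x y → inj) injective?
                ×-dec inversions (fromTable t) % 2 ℕ.≟ 0
  where injective? = all? λ x → all? λ y → fromTable t x Fin.≟ fromTable t y →-dec x Fin.≟ y

alternating : List Table
alternating =
  (f0 , f1 , f2 , f3) ∷ (f0 , f2 , f3 , f1) ∷ (f0 , f3 , f1 , f2) ∷ (f1 , f0 , f3 , f2) ∷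
  (f1 , f2 , f0 , f3) ∷ (f1 , f3 , f2 , f0) ∷ (f2 , f0 , f1 , f3) ∷ (f2 , f1 , f3 , f0) ∷
  (f2 , f3 , f0 , f1) ∷ (f3 , f0 , f2 , f1) ∷ (f3 , f1 , f0 , f2) ∷ (f3 , f2 , f1 , f0) ∷ []

alternating-even : All (IsEvenPerm ∘ fromTable) alternating
alternating-even = from-yes (All.all? IsEvenPerm? alternating)

alternating-complete : ∀ t → IsEvenPerm (fromTable t) → t ∈ alternating
alternating-complete = from-yes (all? λ t → IsEvenPerm? t →-dec (t ∈? alternating))
  where open import Data.List.Membership.DecPropositional _≟T_ using (_∈?_)

table-alternating : ∀ π → IsEvenPerm π → table π ∈ alternating
table-alternating π even =
  alternating-complete (table π) (IsEvenPerm-resp (sym ∘ fromTable-table π) even)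

∀-even : ∀ {Q : Table → Set} → All Q alternating → ∀ π → IsEvenPerm π → Q (table π)
∀-even all π even = All.lookup all (table-alternating π even)

∃-even : ∀ {Q : Table → Set} → Any Q alternating → Σ Table λ t → IsEvenPerm (fromTable t) × Q t
∃-even any = let t , t∈ , q = find any in t , All.lookup alternating-even t∈ , q

lines-nonzero : All (NonZero3 ∘ line) alternating
lines-nonzero = from-yes (All.all? (λ t → ¬? (line t ≟V zeroV)) alternating)

lines-distinct : All (λ t → All (λ t′ → line t ∼ line t′ → t ≡ t′) alternating) alternating
lines-distinct = from-yes
  (All.all? (λ t → All.all? (λ t′ → line t ∼? line t′ →-dec t ≟T t′) alternating) alternating)

lines-external : All (External ∘ line) alternating
lines-external = from-yes (All.all? (External? ∘ line) alternating)

lines-Klein-concurrent :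
  All (λ t → Σ V3 λ P → NonZero3 P × On P lineZ × (∀ v → On P (d (fromTable t ∘ V4 v)))) alternating
lines-Klein-concurrent = from-yes (All.all? (λ t → any? λ P →
  ¬? (P ≟V zeroV) ×-dec On? P lineZ ×-dec all? λ v → On? P (d (fromTable t ∘ V4 v))) alternating)

τ-permutes-lines : ∀ c → tr c ≡ 0F →
  All (λ t → Any (λ t′ → Sends (τ c) (line t) (line t′)) alternating) alternating
τ-permutes-lines = from-yes (all? λ c → tr c ≟F 0F →-dec
  All.all? (λ t → Any.any? (λ t′ → Sends? (τ c) (line t) (line t′)) alternating) alternating)

Φ-permutes-lines : All (λ t → Any (λ t′ → Sends Φ (line t) (line t′)) alternating) alternating
Φ-permutes-lines = from-yes
  (All.all? (λ t → Any.any? (λ t′ → Sends? Φ (line t) (line t′)) alternating) alternating)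

actGen-permutes-lines : ∀ g →
  All (λ t → Any (λ t′ → Sends (actGen g) (line t) (line t′)) alternating) alternating
actGen-permutes-lines (gτ c trc) = τ-permutes-lines c trc
actGen-permutes-lines gΦ         = Φ-permutes-lines

act-permutes-lines : ∀ w {t} → t ∈ alternating →
  Any (λ t′ → Sends (act w) (line t) (line t′)) alternating
act-permutes-lines []      t∈ = Any.map (λ { refl → sends λ P _ P∈l → P∈l }) t∈
act-permutes-lines (g ∷ w) t∈ =
  let t′ , t′∈ , sw = find (act-permutes-lines w t∈)
  in  Any.map (λ sg → Sends-∘ (act-nonzero w) sg sw) (All.lookup (actGen-permutes-lines g) t′∈)

line₀ : V3
line₀ = line (f0 , f1 , f2 , f3)

orbit-from : All (NormalSends line₀ ∘ line) alternating
orbit-from = from-yes (All.all? (NormalSends? line₀ ∘ line) alternating)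

orbit-to : All (λ t → NormalSends (line t) line₀) alternating
orbit-to = from-yes (All.all? (λ t → NormalSends? (line t) line₀) alternating)

normalForms-free : ∀ c → tr c ≡ 0F → ∀ k →
  All (λ t → Sends (τ c ∘ Φ^ k) (line t) (line t) → c ≡ 0F × k ≡ f0) alternating
normalForms-free = from-yes (all? λ c → tr c ≟F 0F →-dec all? λ k →
  All.all? (λ t → Sends? (τ c ∘ Φ^ k) (line t) (line t) →-dec c ≟F 0F ×-dec k Fin.≟ f0) alternating)

d-nonzero : ∀ π → IsEvenPerm π → NonZero3 (d π)
d-nonzero π even = subst NonZero3 (line-table π) (∀-even lines-nonzero π even)

d-injective : ∀ π π′ → IsEvenPerm π → IsEvenPerm π′ → d π ∼ d π′ → ∀ x → π x ≡ π′ x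
d-injective π π′ even even′ d∼d′ x = begin
  π x                      ≡⟨ fromTable-table π x ⟨
  fromTable (table π) x    ≡⟨ cong (λ t → fromTable t x) table≡table′ ⟩
  fromTable (table π′) x   ≡⟨ fromTable-table π′ x ⟩
  π′ x                     ∎
  where
    open ≡-Reasoning
    table≡table′ : table π ≡ table π′
    table≡table′ = ∀-even (∀-even lines-distinct π even) π′ even′
                     (subst₂ _∼_ (sym (line-table π)) (sym (line-table π′)) d∼d′)

d-permuted : ∀ g π → IsEvenPerm π → Σ Perm4 λ π′ → IsEvenPerm π′ × MapsLine g (d π) (d π′)
d-permuted g π even =
  let t′ , even′ , g-sends = ∃-even (act-permutes-lines g (table-alternating π even))
  in  fromTable t′ , even′ ,
      Sends.apply (subst (λ l → Sends (act g) l (line t′)) (line-table π) g-sends)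

d-transitive : ∀ π π′ → IsEvenPerm π → IsEvenPerm π′ → Σ G0 λ g → MapsLine g (d π) (d π′)
d-transitive π π′ even even′ =
  let g , g-sends = subst₂ Reachable (line-table π) (line-table π′)
                      (Reachable-trans (NormalSends⇒Reachable (∀-even orbit-to π even))
                                       (NormalSends⇒Reachable (∀-even orbit-from π′ even′)))
  in  g , Sends.apply g-sends

d-stabilizer-trivial : ∀ g π → IsEvenPerm π → MapsLine g (d π) (d π) → IsId g
d-stabilizer-trivial g π even fixes P _ =
  let normal-fixes = Sends-≗ act-≗ (sends fixes)
      c≡0 , k≡0 = ∀-even (normalForms-free shift shift-trace power) π even
                    (subst (λ l → Sends (τ shift ∘ Φ^ power) l l) (sym (line-table π)) normal-fixes)
      act≡id = trans (act-≗ P) (trans (cong₂ (λ c k → τ c (Φ^ k P)) c≡0 k≡0) (τ-zero P))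
  in  subst (_∼ P) (sym act≡id) (∼-refl P)
  where open NormalForm (normalForm g)

d-external : ∀ π → IsEvenPerm π → External (d π)
d-external π even = subst External (line-table π) (∀-even lines-external π even)

d-Klein-concurrent : ∀ σ → IsEvenPerm σ →
  Σ V3 λ P → NonZero3 P × On P lineZ × (∀ v → On P (d (σ ∘ V4 v)))
d-Klein-concurrent σ even =
  let P , P≢0 , P∈Z , P∈d = ∀-even lines-Klein-concurrent σ even
  in  P , P≢0 , P∈Z , λ v →
        subst (On P) (d-cong (fromTable (table σ) ∘ V4 v) (σ ∘ V4 v) (fromTable-table σ ∘ V4 v)) (P∈d v)

AC₄-d1234-d3241-concurrent :
  Σ V3 λ P → NonZero3 P × On P (join ptA (ptC f3)) × On P (d p1234) × On P (d p3241)
AC₄-d1234-d3241-concurrent = (1F , γ ^F 5 , γ ^F 5) , (λ ()) , refl , refl , refl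

proposition3p7 :
    -- (i) G0 = ⟨Γ,Φ⟩ acts regularly on {d_π | π ∈ A4}; the d_π are genuine, pairwise distinct lines
    ( (∀ (π : Perm4) → IsEvenPerm π → NonZero3 (d π))
    × (∀ (π π' : Perm4) → IsEvenPerm π → IsEvenPerm π' → d π ∼ d π' → ∀ (x : Fin 4) → π x ≡ π' x)
    × (∀ (g : G0) (π : Perm4) → IsEvenPerm π → Σ Perm4 λ π' → IsEvenPerm π' × MapsLine g (d π) (d π'))
    × (∀ (π π' : Perm4) → IsEvenPerm π → IsEvenPerm π' → Σ G0 λ g → MapsLine g (d π) (d π'))
    × (∀ (g : G0) (π : Perm4) → IsEvenPerm π → MapsLine g (d π) (d π) → IsId g) )
    -- (ii) every d_π is external to K
    × (∀ (π : Perm4) → IsEvenPerm π → External (d π))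
    -- (iii) for each coset σV4 in A4, the lines d_{σ∘v}, v ∈ V4, meet in a common point of Z = 0
    × (∀ (σ : Perm4) → IsEvenPerm σ →
         Σ V3 λ P → NonZero3 P × On P lineZ × (∀ (v : Fin 4) → On P (d (σ ∘ V4 v))))
    -- (iv) AC_4, d_1234 and d_3241 are concurrent
    × (Σ V3 λ P → NonZero3 P × On P (join ptA (ptC f3)) × On P (d p1234) × On P (d p3241))
proposition3p7 =
  (d-nonzero , d-injective , d-permuted , d-transitive , d-stabilizer-trivial) ,
  d-external , d-Klein-concurrent , AC₄-d1234-d3241-concurrent
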